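{- Let $n,k \geq 1$, let $\rho \in \mathcal{P}_k$, and let $\sigma \in \mathcal{I}_n \cap \mathcal{P}_n$ be a sequence containing the pattern $\rho$. Then $\sigma$ is a $\rho$-minimal inversion sequence if and only if for every set $R \subseteq [1,n]$ such that $\rho' := (\sigma_i)_{i \in R}$ (indices taken in increasing order) is an occurrence of $\rho$, both of the following conditions hold: 1. $[\max(\mathbf{Sat}(\sigma)), n] \subseteq R$; 2. every value of $\sigma$ which does not appear in $\rho'$ appears at least twice in $\sigma$.
   Context: For integers $a \le b$, $[a,b]=\{k\in\mathbb Z : a\le k\le b\}$. An inversion sequence of length $n$ is an integer sequence $\sigma=(\sigma_1,\dots,\sigma_n)$ with $\sigma_i\in\{0,\dots,i-1\}$ for all $i$; $\mathcal{I}_n$ is the set of these and $\mathcal I=\bigcup_n \mathcal I_n$. A Cayley permutation of length $n$ is an integer sequence of length $n$ whose set of values is exactly $\{0,\dots,\max(\rho)\}$; $\mathcal{P}_n$ is the set of these and $\mathcal P=\bigcup_n\mathcal P_n$. For integer sequences $\sigma$ (length $n$) and $\rho$ (length $k$, $1\le k\le n$), $\sigma$ contains $\rho$ (written $\rho\preceq\sigma$) if some subsequence of $k$ entries of $\sigma$ has its values in the same relative order as $\rho$ (i.e. for all $a,b$, the $a$-th entry is $<,=,>$ the $b$-th entry iff $\rho_a <,=,> \rho_b$); such a subsequence is an occurrence of $\rho$. For a nonnegative integer sequence $\sigma$ of length $n\ge1$: $\mathbf{mdd}(\sigma)=\max_{i\in[1,n]}(\sigma_i-i+1)$, and $\mathbf{Sat}(\sigma)=\{i\in[1,n]:\sigma_i-i+1=\mathbf{mdd}(\sigma)\}$.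 For a nonempty Cayley permutation (pattern) $\rho$, let $\mathcal{IP}[\rho]=\{\sigma\in\mathcal I\cap\mathcal P : \rho\preceq\sigma\}$; $\sigma$ is a $\rho$-minimal inversion sequence if it is a minimal element of the poset $(\mathcal{IP}[\rho],\preceq)$. -}

module Defs where

open import Data.Nat using (ℕ; zero; suc; _≤_; _<_)
open import Data.Integer as ℤ using (ℤ; +_; _-_; _⊔_)
open import Data.Fin using (Fin; toℕ)
open import Data.List using (List; []; _∷_; length; lookup)
open import Data.Product using (Σ; _×_; ∃; ∃-syntax)
open import Function using (_⇔_)
open import Relation.Binary.PropositionalEquality using (_≡_; _≢_)

-- Sequences are lists of naturals; positions are 0-based (Fin (length σ)),
-- so paper position i corresponds to Fin index i - 1.

IsInversionSeq : List ℕ → Set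
IsInversionSeq σ = ∀ (j : Fin (length σ)) → lookup σ j ≤ toℕ j

-- Cayley permutation: the set of values is exactly {0,…,max σ}
IsCayley : List ℕ → Set
IsCayley σ = ∀ (v : ℕ) → (∃[ i ] v ≤ lookup σ i) → ∃[ i ] lookup σ i ≡ v

-- strictly increasing index map (= a subset of positions, taken in increasing order)
StrictInc : ∀ {k n} → (Fin k → Fin n) → Set
StrictInc e = ∀ a b → toℕ a < toℕ b → toℕ (e a) < toℕ (e b)

IsOccurrence : (ρ σ : List ℕ) → (Fin (length ρ) → Fin (length σ)) → Set
IsOccurrence ρ σ e =
  StrictInc e ×
  (∀ a b → (lookup ρ a < lookup ρ b ⇔ lookup σ (e a) < lookup σ (e b))
         × (lookup ρ a ≡ lookup ρ b ⇔ lookup σ (e a) ≡ lookup σ (e b))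
         × (lookup ρ b < lookup ρ a ⇔ lookup σ (e b) < lookup σ (e a)))

-- ρ ⪯ σ  (1 ≤ length ρ; length ρ ≤ length σ is forced by the embedding)
Contains : (ρ σ : List ℕ) → Set
Contains ρ σ = 1 ≤ length ρ × ∃[ e ] IsOccurrence ρ σ e

InIP : (ρ σ : List ℕ) → Set
InIP ρ σ = IsInversionSeq σ × IsCayley σ × Contains ρ σ

IsMinimal : (ρ σ : List ℕ) → Set
IsMinimal ρ σ = InIP ρ σ × (∀ τ → InIP ρ τ → Contains τ σ → τ ≡ σ)

-- mdd(σ) = max_i (σ_i - i + 1) (1-based i) = max_j (σ_j - j) (0-based j)
mddFrom : ℕ → ℕ → List ℕ → ℤ
mddFrom j x [] = + x - + j
mddFrom j x (y ∷ ys) = (+ x - + j) ⊔ mddFrom (suc j) y ys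

mdd : List ℕ → ℤ
mdd [] = + 0   -- junk value, mdd only used for nonempty σ
mdd (x ∷ xs) = mddFrom 0 x xs

InSat : (σ : List ℕ) → Fin (length σ) → Set
InSat σ j = + lookup σ j - + toℕ j ≡ mdd σ

-- condition 1: [max Sat(σ), n] ⊆ R, where R = image of e
-- (a position j satisfies j ≥ max Sat iff it is ≥ every element of Sat)
Cond1 : (ρ σ : List ℕ) → (Fin (length ρ) → Fin (length σ)) → Set
Cond1 ρ σ e = ∀ (j : Fin (length σ)) →
  (∀ s → InSat σ s → toℕ s ≤ toℕ j) → ∃[ a ] e a ≡ j

Cond2 : (ρ σ : List ℕ) → (Fin (length ρ) → Fin (length σ)) → Set
Cond2 ρ σ e = ∀ (i : Fin (length σ)) →
  (∀ a → lookup σ (e a) ≢ lookup σ i) →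
  ∃[ i₁ ] ∃[ i₂ ] (i₁ ≢ i₂ × lookup σ i₁ ≡ lookup σ i × lookup σ i₂ ≡ lookup σ i)

-- For an inversion sequence mdd σ = 0, so Sat σ is the set of fixed points σ_j = j
-- (0-based).
--
-- (⇒) Suppose an occurrence of ρ avoids a position i that lies after the last fixed
-- point, or whose value occurs nowhere else in σ. Delete σ_i and, if its value was unique,
-- lower every larger value by one. The entries after i move one place left and stay within
-- bounds: in the first case they were not fixed points, in the second they are either
-- lowered or at most σ_i ≤ i. The result is a shorter Cayley inversion sequence below σ
-- that still contains ρ, contradicting minimality.
--
-- (⇐) Let τ ∈ IP[ρ] occur in σ at positions f, and let s be the last fixed point of σ.
-- Positions from s on are covered by f, so a missed position p lies below s. The s values
-- below σ_s = s then inject into the s − 1 positions below s other than p: a value of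
-- σ ∘ f, equal to σ (f q), goes to f k for the position k = τ_q of τ, which lies before
-- the preimage t of s since τ_q < τ_t ≤ t; any other value goes to a position holding it,
-- which can be taken ≠ p by condition 2. Hence f is onto, and Cayley permutations related
-- by a surjective occurrence coincide.

module Submission where

open import Defs
open import Data.Nat as ℕ
  using (ℕ; zero; suc; pred; _+_; _≤_; _<_; z≤n; s≤s; z<s; s<s; _≟_; _<?_; _≤?_)
open import Data.Nat.Properties
open import Data.Integer as ℤ using (+_; _-_)
import Data.Integer.Properties as ℤ
open import Data.Fin using (Fin; toℕ; zero; suc; fromℕ<; cast; punchOut)
import Data.Fin.Properties as Fin
open import Data.List using (List; []; _∷_; length; lookup; map)
open import Data.List.Properties using (length-map)
open import Data.Product using (Σ-syntax; ∃-syntax; _×_; _,_; proj₁; proj₂)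
open import Data.Sum using (_⊎_; inj₁; inj₂)
open import Data.Empty using (⊥; ⊥-elim)
open import Function using (_∘_; id; _⇔_; mk⇔; Injective)
open import Function.Bundles using (Equivalence)
import Function.Properties.Equivalence as ⇔
open import Relation.Binary.PropositionalEquality
open import Relation.Binary.Definitions using (tri<; tri≈; tri>)
open import Relation.Nullary using (Dec; yes; no; ¬_)
open import Relation.Nullary.Decidable using (_×-dec_; ¬?)
open import Relation.Unary using (Decidable)

open Equivalence

mddFrom≤0 : ∀ j x xs → x ≤ j → (∀ k → lookup xs k ≤ suc (j + toℕ k)) →
            mddFrom j x xs ℤ.≤ + 0
mddFrom≤0 j x []       x≤j _ = ℤ.i≤j⇒i-j≤0 (ℤ.+≤+ x≤j)
mddFrom≤0 j x (y ∷ ys) x≤j h = ℤ.⊔-lub (ℤ.i≤j⇒i-j≤0 (ℤ.+≤+ x≤j))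
  (mddFrom≤0 (suc j) y ys (subst (y ≤_) (cong suc (+-identityʳ j)) (h zero))
    (λ k → subst (lookup ys k ≤_) (cong suc (+-suc j (toℕ k))) (h (suc k))))

mddFrom-≥head : ∀ j x xs → + x - + j ℤ.≤ mddFrom j x xs
mddFrom-≥head j x []      = ℤ.≤-refl
mddFrom-≥head j x (_ ∷ _) = ℤ.i≤i⊔j _ _

mdd-inversionSeq : ∀ σ → IsInversionSeq σ → 1 ≤ length σ → mdd σ ≡ + 0
mdd-inversionSeq (x ∷ xs) inv _ with inv zero
... | z≤n = ℤ.≤-antisym (mddFrom≤0 0 0 xs z≤n (inv ∘ suc)) (mddFrom-≥head 0 0 xs)

inSat⇔fixed : ∀ σ → IsInversionSeq σ → 1 ≤ length σ →
              ∀ j → InSat σ j ⇔ lookup σ j ≡ toℕ j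
inSat⇔fixed σ inv σ≢[] j = mk⇔
  (λ sat → ℤ.+-injective (ℤ.i-j≡0⇒i≡j _ _ (trans sat mdd≡0)))
  (λ fixed → trans (ℤ.i≡j⇒i-j≡0 (cong +_ fixed)) (sym mdd≡0))
  where
  mdd≡0 : mdd σ ≡ + 0
  mdd≡0 = mdd-inversionSeq σ inv σ≢[]

SameOrder : ℕ → ℕ → ℕ → ℕ → Set
SameOrder x y x′ y′ = (x < y ⇔ x′ < y′) × (x ≡ y ⇔ x′ ≡ y′) × (y < x ⇔ y′ < x′)

sameOrder-sym : ∀ {x y x′ y′} → SameOrder x y x′ y′ → SameOrder x′ y′ x y
sameOrder-sym (lt , eq , gt) = ⇔.sym lt , ⇔.sym eq , ⇔.sym gt

sameOrder-trans : ∀ {x y x′ y′ x″ y″} →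
  SameOrder x y x′ y′ → SameOrder x′ y′ x″ y″ → SameOrder x y x″ y″
sameOrder-trans (lt , eq , gt) (lt′ , eq′ , gt′) =
  ⇔.trans lt lt′ , ⇔.trans eq eq′ , ⇔.trans gt gt′

strictMono-reflects-< : ∀ {x y} (f : ℕ → ℕ) →
  (x < y → f x < f y) → (y < x → f y < f x) → f x < f y → x < y
strictMono-reflects-< {x} {y} f mono< mono> fx<fy with <-cmp x y
... | tri< x<y _ _ = x<y
... | tri≈ _ x≡y _ = ⊥-elim (<-irrefl (cong f x≡y) fx<fy)
... | tri> _ _ y<x = ⊥-elim (<-asym fx<fy (mono> y<x))

strictMono-reflects-≡ : ∀ {x y} (f : ℕ → ℕ) →
  (x < y → f x < f y) → (y < x → f y < f x) → f x ≡ f y → x ≡ y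
strictMono-reflects-≡ {x} {y} f mono< mono> fx≡fy with <-cmp x y
... | tri< x<y _ _ = ⊥-elim (<-irrefl fx≡fy (mono< x<y))
... | tri≈ _ x≡y _ = x≡y
... | tri> _ _ y<x = ⊥-elim (<-irrefl (sym fx≡fy) (mono> y<x))

sameOrder-image : ∀ {x y} (f : ℕ → ℕ) →
  (x < y → f x < f y) → (y < x → f y < f x) → SameOrder x y (f x) (f y)
sameOrder-image f mono< mono> =
  mk⇔ mono< (strictMono-reflects-< f mono< mono>) ,
  mk⇔ (cong f) (strictMono-reflects-≡ f mono< mono>) ,
  mk⇔ mono> (strictMono-reflects-< f mono> mono<)

occurrence-∘ : ∀ {ρ τ σ g f} →
  IsOccurrence ρ τ g → IsOccurrence τ σ f → IsOccurrence ρ σ (f ∘ g)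
occurrence-∘ {g = g} (g-inc , g-order) (f-inc , f-order) =
  (λ a b a<b → f-inc (g a) (g b) (g-inc a b a<b)) ,
  (λ a b → sameOrder-trans (g-order a b) (f-order (g a) (g b)))

strictInc-injective : ∀ {m n} {f : Fin m → Fin n} → StrictInc f → Injective _≡_ _≡_ f
strictInc-injective {f = f} inc {a} {b} fa≡fb with <-cmp (toℕ a) (toℕ b)
... | tri< a<b _ _ = ⊥-elim (<-irrefl (cong toℕ fa≡fb) (inc a b a<b))
... | tri≈ _ a≡b _ = Fin.toℕ-injective a≡b
... | tri> _ _ b<a = ⊥-elim (<-irrefl (cong toℕ (sym fa≡fb)) (inc b a b<a))

strictInc-reflects-< : ∀ {m n} {f : Fin m → Fin n} → StrictInc f →
  ∀ a b → toℕ (f a) < toℕ (f b) → toℕ a < toℕ b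
strictInc-reflects-< {f = f} inc a b fa<fb with <-cmp (toℕ a) (toℕ b)
... | tri< a<b _ _ = a<b
... | tri≈ _ a≡b _ = ⊥-elim (<-irrefl (cong (toℕ ∘ f) (Fin.toℕ-injective a≡b)) fa<fb)
... | tri> _ _ b<a = ⊥-elim (<-asym fa<fb (inc b a b<a))

lookup-map : ∀ {A B : Set} (f : A → B) xs k →
             lookup (map f xs) k ≡ f (lookup xs (cast (length-map f xs) k))
lookup-map f (x ∷ xs) zero    = refl
lookup-map f (x ∷ xs) (suc k) = lookup-map f xs k

module _ {A B : Set} (f : A → B) where

  removeWith : (xs : List A) → Fin (length xs) → List B
  removeWith (x ∷ xs) zero    = map f xs
  removeWith (x ∷ xs) (suc i) = f x ∷ removeWith xs i

  skip : (xs : List A) (i : Fin (length xs)) → Fin (length (removeWith xs i)) → Fin (length xs)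
  skip (x ∷ xs) zero    k       = suc (cast (length-map f xs) k)
  skip (x ∷ xs) (suc i) zero    = zero
  skip (x ∷ xs) (suc i) (suc k) = suc (skip xs i k)

  length-removeWith : ∀ xs i → suc (length (removeWith xs i)) ≡ length xs
  length-removeWith (x ∷ xs) zero    = cong suc (length-map f xs)
  length-removeWith (x ∷ xs) (suc i) = cong suc (length-removeWith xs i)

  lookup-removeWith : ∀ xs i k → lookup (removeWith xs i) k ≡ f (lookup xs (skip xs i k))
  lookup-removeWith (x ∷ xs) zero    k       = lookup-map f xs k
  lookup-removeWith (x ∷ xs) (suc i) zero    = refl
  lookup-removeWith (x ∷ xs) (suc i) (suc k) = lookup-removeWith xs i k

  skip≢ : ∀ xs i k → skip xs i k ≢ i
  skip≢ (x ∷ xs) (suc i) (suc k) eq = skip≢ xs i k (Fin.suc-injective eq)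

  skip-surjective : ∀ xs i j → j ≢ i → ∃[ k ] skip xs i k ≡ j
  skip-surjective (x ∷ xs) zero    zero    j≢i = ⊥-elim (j≢i refl)
  skip-surjective (x ∷ xs) zero    (suc j) _   =
    cast (sym (length-map f xs)) j ,
    cong suc (Fin.cast-involutive (length-map f xs) (sym (length-map f xs)) j)
  skip-surjective (x ∷ xs) (suc i) zero    _   = zero , refl
  skip-surjective (x ∷ xs) (suc i) (suc j) j≢i =
    let k , eq = skip-surjective xs i j (j≢i ∘ cong suc) in suc k , cong suc eq

  skip-strictInc : ∀ xs i → StrictInc (skip xs i)
  skip-strictInc (x ∷ xs) zero    a       b       a<b =
    s<s (subst₂ _<_ (sym (Fin.toℕ-cast _ a)) (sym (Fin.toℕ-cast _ b)) a<b)
  skip-strictInc (x ∷ xs) (suc i) zero    (suc b) _         = z<s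
  skip-strictInc (x ∷ xs) (suc i) (suc a) (suc b) (s<s a<b) = s<s (skip-strictInc xs i a b a<b)

  toℕ-skip : ∀ xs i k → toℕ (skip xs i k) ≡ toℕ k ⊎
                        (toℕ (skip xs i k) ≡ suc (toℕ k) × toℕ i < toℕ (skip xs i k))
  toℕ-skip (x ∷ xs) zero    k       = inj₂ (cong suc (Fin.toℕ-cast _ k) , z<s)
  toℕ-skip (x ∷ xs) (suc i) zero    = inj₁ refl
  toℕ-skip (x ∷ xs) (suc i) (suc k) with toℕ-skip xs i k
  ... | inj₁ eq         = inj₁ (cong suc eq)
  ... | inj₂ (eq , i<) = inj₂ (cong suc eq , s<s i<)

-- closeGap v : ℕ ∖ {v} → ℕ is an order isomorphism, with inverse openGap v.
closeGap : ℕ → ℕ → ℕ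
closeGap v x with v <? x
... | yes _ = pred x
... | no  _ = x

openGap : ℕ → ℕ → ℕ
openGap v w with w <? v
... | yes _ = w
... | no  _ = suc w

closeGap-above : ∀ {v x} → v < x → closeGap v x ≡ pred x
closeGap-above {v} {x} v<x with v <? x
... | yes _    = refl
... | no  v≮x = ⊥-elim (v≮x v<x)

closeGap-notAbove : ∀ {v x} → ¬ v < x → closeGap v x ≡ x
closeGap-notAbove {v} {x} v≮x with v <? x
... | yes v<x = ⊥-elim (v≮x v<x)
... | no  _   = refl

closeGap-≤ : ∀ {v x} → closeGap v x ≤ x
closeGap-≤ {v} {x} with v <? x
... | yes _ = pred[n]≤n
... | no  _ = ≤-refl

closeGap-< : ∀ {v x p} → x ≤ p → v < p → closeGap v x < p
closeGap-< {v} {x} x≤p v<p with v <? x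
closeGap-< {x = suc x} x≤p _ | yes _ = x≤p
... | no v≮x = ≤-<-trans (≮⇒≥ v≮x) v<p

closeGap-mono : ∀ {v x y} → x ≢ v → y ≢ v → x < y → closeGap v x < closeGap v y
closeGap-mono {v} {x} {y} x≢v y≢v x<y with v <? x | v <? y
closeGap-mono {x = suc x} {suc y} _ _ (s<s x<y) | yes _ | yes _ = x<y
... | yes v<x | no  v≮y = ⊥-elim (v≮y (<-trans v<x x<y))
closeGap-mono {y = suc y} x≢v _ _ | no v≮x | yes v<y = ≤-trans (≤∧≢⇒< (≮⇒≥ v≮x) x≢v) (ℕ.s≤s⁻¹ v<y)
... | no  _   | no  _   = x<y

openGap-≢ : ∀ {v w} → openGap v w ≢ v
openGap-≢ {v} {w} with w <? v
... | yes w<v = <⇒≢ w<v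
... | no  w≮v = <⇒≢ (s≤s (≮⇒≥ w≮v)) ∘ sym

closeGap-openGap : ∀ {v w} → closeGap v (openGap v w) ≡ w
closeGap-openGap {v} {w} with w <? v
... | yes w<v = closeGap-notAbove (<-asym w<v)
... | no  w≮v = closeGap-above (s≤s (≮⇒≥ w≮v))

openGap-≤ : ∀ {v w x} → x ≢ v → w ≤ closeGap v x → openGap v w ≤ x
openGap-≤ {v} {w} {x} x≢v w≤ with w <? v
... | yes _ = ≤-trans w≤ closeGap-≤
... | no w≮v with v <? x
openGap-≤ {x = suc x} _ w≤ | no _ | yes _ = s≤s w≤
...   | no v≮x = ⊥-elim (x≢v (≤-antisym (≮⇒≥ v≮x) (≤-trans (≮⇒≥ w≮v) w≤)))

contains⇒nonempty : ∀ {ρ τ} → Contains ρ τ → 1 ≤ length τ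
contains⇒nonempty (ρ≢[] , g , _) = ≤-trans (s≤s z≤n) (Fin.toℕ<n (g (fromℕ< ρ≢[])))

module _ {σ : List ℕ} (adj : ℕ → ℕ) (i : Fin (length σ)) where

  private
    τ : List ℕ
    τ = removeWith adj σ i

    E : Fin (length τ) → Fin (length σ)
    E = skip adj σ i

    lookup-τ : ∀ k → lookup τ k ≡ adj (lookup σ (E k))
    lookup-τ = lookup-removeWith adj σ i

  removeWith-inversionSeq : IsInversionSeq σ → (∀ x → adj x ≤ x) →
    (∀ p → toℕ i < toℕ p → adj (lookup σ p) < toℕ p) →
    IsInversionSeq (removeWith adj σ i)
  removeWith-inversionSeq inv adj≤ adj<after k rewrite lookup-τ k with toℕ-skip adj σ i k
  ... | inj₁ Ek≡k = ≤-trans (adj≤ _) (subst (lookup σ (E k) ≤_) Ek≡k (inv (E k)))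
  ... | inj₂ (Ek≡1+k , i<Ek) =
    ℕ.s≤s⁻¹ (subst (adj (lookup σ (E k)) <_) Ek≡1+k (adj<after (E k) i<Ek))

  removeWith-cayley :
    (∀ w p → p ≢ i → w ≤ adj (lookup σ p) → ∃[ r ] r ≢ i × adj (lookup σ r) ≡ w) →
    IsCayley (removeWith adj σ i)
  removeWith-cayley adj-onto v (k , v≤τk) =
    let r , r≢i , adjσr≡v = adj-onto v (E k) (skip≢ adj σ i k) (subst (v ≤_) (lookup-τ k) v≤τk)
        k′ , Ek′≡r = skip-surjective adj σ i r r≢i
    in k′ , trans (lookup-τ k′) (trans (cong (adj ∘ lookup σ) Ek′≡r) adjσr≡v)

  module _ (adj-mono : ∀ p q → p ≢ i → q ≢ i →
                       lookup σ p < lookup σ q → adj (lookup σ p) < adj (lookup σ q)) where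

    private
      sameOrder-skip : ∀ a b →
        SameOrder (lookup σ (E a)) (lookup σ (E b)) (lookup τ a) (lookup τ b)
      sameOrder-skip a b rewrite lookup-τ a | lookup-τ b =
        sameOrder-image adj (adj-mono (E a) (E b) (skip≢ adj σ i a) (skip≢ adj σ i b))
                            (adj-mono (E b) (E a) (skip≢ adj σ i b) (skip≢ adj σ i a))

    removeWith-occurrence : IsOccurrence (removeWith adj σ i) σ (skip adj σ i)
    removeWith-occurrence = skip-strictInc adj σ i , λ a b → sameOrder-sym (sameOrder-skip a b)

    removeWith-contains : ∀ {ρ e} → 1 ≤ length ρ → IsOccurrence ρ σ e → (∀ a → e a ≢ i) →
                          Contains ρ (removeWith adj σ i)
    removeWith-contains {ρ} {e} ρ≢[] (e-inc , e-order) i∉e = ρ≢[] , g , g-inc , g-order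
      where
      g : Fin (length ρ) → Fin (length τ)
      g a = proj₁ (skip-surjective adj σ i (e a) (i∉e a))

      Eg≡e : ∀ a → E (g a) ≡ e a
      Eg≡e a = proj₂ (skip-surjective adj σ i (e a) (i∉e a))

      g-inc : StrictInc g
      g-inc a b a<b = strictInc-reflects-< (skip-strictInc adj σ i) (g a) (g b)
        (subst₂ (λ u w → toℕ u < toℕ w) (sym (Eg≡e a)) (sym (Eg≡e b)) (e-inc a b a<b))

      g-order : ∀ a b → SameOrder (lookup ρ a) (lookup ρ b) (lookup τ (g a)) (lookup τ (g b))
      g-order a b = sameOrder-trans
        (subst₂ (λ u w → SameOrder (lookup ρ a) (lookup ρ b) (lookup σ u) (lookup σ w))
                (sym (Eg≡e a)) (sym (Eg≡e b)) (e-order a b))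
        (sameOrder-skip (g a) (g b))

module _ {ρ σ : List ℕ} (inv : IsInversionSeq σ) (cay : IsCayley σ)
         (minimal : ∀ τ → InIP ρ τ → Contains τ σ → τ ≡ σ) (ρ≢[] : 1 ≤ length ρ)
         {e : Fin (length ρ) → Fin (length σ)} (occ : IsOccurrence ρ σ e)
         (i : Fin (length σ)) (i∉e : ∀ a → e a ≢ i) where

  removeWith-contradicts-minimality : (adj : ℕ → ℕ) →
    (∀ x → adj x ≤ x) →
    (∀ p q → p ≢ i → q ≢ i → lookup σ p < lookup σ q → adj (lookup σ p) < adj (lookup σ q)) →
    (∀ p → toℕ i < toℕ p → adj (lookup σ p) < toℕ p) →
    (∀ w p → p ≢ i → w ≤ adj (lookup σ p) → ∃[ r ] r ≢ i × adj (lookup σ r) ≡ w) →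
    ⊥
  removeWith-contradicts-minimality adj adj≤ adj-mono adj<after adj-onto =
    1+n≢n (trans (length-removeWith adj σ i) (cong length (sym τ≡σ)))
    where
    ρ⊆τ : Contains ρ (removeWith adj σ i)
    ρ⊆τ = removeWith-contains {σ} adj i adj-mono {ρ} ρ≢[] occ i∉e

    τ≡σ : removeWith adj σ i ≡ σ
    τ≡σ = minimal (removeWith adj σ i)
      (removeWith-inversionSeq {σ} adj i inv adj≤ adj<after , removeWith-cayley {σ} adj i adj-onto , ρ⊆τ)
      (contains⇒nonempty {ρ} {removeWith adj σ i} ρ⊆τ , skip adj σ i , removeWith-occurrence {σ} adj i adj-mono)

  removeUnique-contradicts-minimality :
    (∀ p → p ≢ i → lookup σ p ≢ lookup σ i) →
    (∀ p → toℕ i < toℕ p → closeGap (lookup σ i) (lookup σ p) < toℕ p) →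
    ⊥
  removeUnique-contradicts-minimality unique after =
    removeWith-contradicts-minimality (closeGap v) (λ _ → closeGap-≤)
      (λ p q p≢i q≢i → closeGap-mono (unique p p≢i) (unique q q≢i)) after onto
    where
    v : ℕ
    v = lookup σ i
    onto : ∀ w p → p ≢ i → w ≤ closeGap v (lookup σ p) →
           ∃[ r ] r ≢ i × closeGap v (lookup σ r) ≡ w
    onto w p p≢i w≤ =
      let r , σr≡ = cay (openGap v w) (p , openGap-≤ {v} {w} (unique p p≢i) w≤)
      in r , (λ r≡i → openGap-≢ {v} {w} (trans (sym σr≡) (cong (lookup σ) r≡i))) ,
         trans (cong (closeGap v) σr≡) (closeGap-openGap {v} {w})

  removeRepeated-contradicts-minimality :
    ∀ i′ → i′ ≢ i → lookup σ i′ ≡ lookup σ i →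
    (∀ p → toℕ i < toℕ p → lookup σ p < toℕ p) →
    ⊥
  removeRepeated-contradicts-minimality i′ i′≢i σi′≡σi after =
    removeWith-contradicts-minimality id (λ _ → ≤-refl) (λ _ _ _ _ → id) after onto
    where
    onto : ∀ w p → p ≢ i → w ≤ lookup σ p → ∃[ r ] r ≢ i × lookup σ r ≡ w
    onto w p _ w≤σp with cay w (p , w≤σp)
    ... | r , σr≡w with r Fin.≟ i
    ...   | yes refl = i′ , i′≢i , trans σi′≡σi σr≡w
    ...   | no  r≢i  = r , r≢i , σr≡w

minimal⇒conditions : ∀ {ρ σ} → 1 ≤ length σ → IsInversionSeq σ → IsCayley σ → IsMinimal ρ σ →
  ∀ e → IsOccurrence ρ σ e → Cond1 ρ σ e × Cond2 ρ σ e
minimal⇒conditions {ρ} {σ} σ≢[] inv cay ((_ , _ , ρ≢[] , _) , minimal) e occ = cond1 , cond2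
  where
  repeated? : ∀ i → Dec (∃[ p ] p ≢ i × lookup σ p ≡ lookup σ i)
  repeated? i = Fin.any? (λ p → ¬? (p Fin.≟ i) ×-dec (lookup σ p ≟ lookup σ i))

  unfixedAfter : ∀ j → (∀ s → InSat σ s → toℕ s ≤ toℕ j) →
                 ∀ p → toℕ j < toℕ p → lookup σ p < toℕ p
  unfixedAfter j j≥Sat p j<p =
    ≤∧≢⇒< (inv p) (λ fixed → <⇒≱ j<p (j≥Sat p (from (inSat⇔fixed σ inv σ≢[] p) fixed)))

  cond1 : Cond1 ρ σ e
  cond1 j j≥Sat with Fin.any? (λ a → e a Fin.≟ j)
  ... | yes hit = hit
  ... | no miss with repeated? j
  ...   | yes (p , p≢j , σp≡σj) =
    ⊥-elim (removeRepeated-contradicts-minimality {ρ} {σ} inv cay minimal ρ≢[] {e} occ j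
              (λ a eq → miss (a , eq)) p p≢j σp≡σj (unfixedAfter j j≥Sat))
  ...   | no unique =
    ⊥-elim (removeUnique-contradicts-minimality {ρ} {σ} inv cay minimal ρ≢[] {e} occ j
              (λ a eq → miss (a , eq)) (λ p p≢j eq → unique (p , p≢j , eq))
              (λ p j<p → ≤-<-trans closeGap-≤ (unfixedAfter j j≥Sat p j<p)))

  cond2 : Cond2 ρ σ e
  cond2 i σi∉ with repeated? i
  ... | yes (p , p≢i , σp≡σi) = i , p , p≢i ∘ sym , refl , σp≡σi
  ... | no unique =
    ⊥-elim (removeUnique-contradicts-minimality {ρ} {σ} inv cay minimal ρ≢[] {e} occ i
              (λ a eq → σi∉ a (cong (lookup σ) eq)) (λ p p≢i eq → unique (p , p≢i , eq))
              (λ p i<p → closeGap-< (inv p) (≤-<-trans (inv i) i<p)))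

greatest : ∀ {n} {P : Fin n → Set} → Decidable P → ∃[ j ] P j →
           ∃[ s ] P s × (∀ j → P j → toℕ j ≤ toℕ s)
greatest {zero} _ (() , _)
greatest {suc n} P? witness with Fin.any? (P? ∘ suc)
... | yes later =
  let s , Ps , s-max = greatest (P? ∘ suc) later
  in suc s , Ps , λ { zero _ → z≤n ; (suc j) Pj → s≤s (s-max j Pj) }
... | no none with witness
...   | zero , P0  = zero , P0 , λ { zero _ → z≤n ; (suc j) Pj → ⊥-elim (none (j , Pj)) }
...   | suc j , Pj = ⊥-elim (none (j , Pj))

noInjection-avoiding : ∀ {S n} (F : Fin S → Fin n) (p : Fin n) → toℕ p < S →
  (∀ u → toℕ (F u) < S) → (∀ u → F u ≢ p) → Injective _≡_ _≡_ F → ⊥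
noInjection-avoiding {suc S} F p p<S F<S F≢p F-inj = 1+n≰n (Fin.injective⇒≤ G-inj)
  where
  p≢F : ∀ u → fromℕ< p<S ≢ fromℕ< (F<S u)
  p≢F u eq = F≢p u (Fin.toℕ-injective (sym (Fin.fromℕ<-injective _ _ p<S (F<S u) eq)))
  G : Fin (suc S) → Fin S
  G u = punchOut (p≢F u)
  G-inj : Injective _≡_ _≡_ G
  G-inj {u} {v} eq = F-inj (Fin.toℕ-injective
    (Fin.fromℕ<-injective _ _ (F<S u) (F<S v) (Fin.punchOut-injective (p≢F u) (p≢F v) eq)))

module _ {σ τ : List ℕ} (σ-cayley : IsCayley σ) (τ-inversion : IsInversionSeq τ)
         {f : Fin (length τ) → Fin (length σ)} (occ : IsOccurrence τ σ f)
         (s : Fin (length σ)) (σs≡s : lookup σ s ≡ toℕ s)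
         (covers : ∀ j → toℕ s ≤ toℕ j → ∃[ a ] f a ≡ j)
         (repeats : ∀ i → (∀ a → lookup σ (f a) ≢ lookup σ i) →
                    ∃[ i′ ] i′ ≢ i × lookup σ i′ ≡ lookup σ i)
  where

  private
    -- In byRank, r = f k where the position k of τ is the value τ_q of u's preimage q.
    data Encodes (u : ℕ) (r : Fin (length σ)) : Set where
      byRank  : ∀ q k → lookup σ (f q) ≡ u → f k ≡ r → toℕ k ≡ lookup τ q → Encodes u r
      byValue : lookup σ r ≡ u → (∀ a → f a ≢ r) → Encodes u r

    encodes-injective : ∀ {u v r} → Encodes u r → Encodes v r → u ≡ v
    encodes-injective (byRank q k σfq≡u fk≡r k≡τq) (byRank q′ k′ σfq′≡v fk′≡r k′≡τq′) =
      trans (sym σfq≡u) (trans (to (proj₁ (proj₂ (proj₂ occ q q′))) τq≡τq′) σfq′≡v)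
      where
      k≡k′ : k ≡ k′
      k≡k′ = strictInc-injective (proj₁ occ) (trans fk≡r (sym fk′≡r))
      τq≡τq′ : lookup τ q ≡ lookup τ q′
      τq≡τq′ = trans (sym k≡τq) (trans (cong toℕ k≡k′) k′≡τq′)
    encodes-injective (byRank _ k _ fk≡r _) (byValue _ r∉f) = ⊥-elim (r∉f k fk≡r)
    encodes-injective (byValue _ r∉f) (byRank _ k _ fk≡r _) = ⊥-elim (r∉f k fk≡r)
    encodes-injective (byValue σr≡u _) (byValue σr≡v _)     = trans (sym σr≡u) σr≡v

    missing<s : ∀ j → (∀ a → f a ≢ j) → toℕ j < toℕ s
    missing<s j j∉f with toℕ s ≤? toℕ j
    ... | yes s≤j = let a , fa≡j = covers j s≤j in ⊥-elim (j∉f a fa≡j)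
    ... | no  s≰j = ≰⇒> s≰j

    t : Fin (length τ)
    t = proj₁ (covers s ≤-refl)

    ft≡s : f t ≡ s
    ft≡s = proj₂ (covers s ≤-refl)

    valueElsewhere : ∀ p u → u < toℕ s → (∀ a → lookup σ (f a) ≢ u) →
                     ∃[ r ] r ≢ p × lookup σ r ≡ u
    valueElsewhere p u u<s u∉σf with u ≟ lookup σ p
    ... | yes u≡σp =
      let i′ , i′≢p , σi′≡σp = repeats p (λ a σfa≡σp → u∉σf a (trans σfa≡σp (sym u≡σp)))
      in i′ , i′≢p , trans σi′≡σp (sym u≡σp)
    ... | no u≢σp =
      let r , σr≡u = σ-cayley u (s , subst (u ≤_) (sym σs≡s) (<⇒≤ u<s))
      in r , (λ r≡p → u≢σp (trans (sym σr≡u) (cong (lookup σ) r≡p))) , σr≡u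

    encode : ∀ p → (∀ a → f a ≢ p) → ∀ u → u < toℕ s →
             Σ[ r ∈ Fin (length σ) ] toℕ r < toℕ s × r ≢ p × Encodes u r
    encode p p∉f u u<s with Fin.any? (λ q → lookup σ (f q) ≟ u)
    ... | yes (q , σfq≡u) = f k , fk<s , p∉f k , byRank q k σfq≡u refl (Fin.toℕ-fromℕ< τq<|τ|)
      where
      τq<τt : lookup τ q < lookup τ t
      τq<τt = from (proj₁ (proj₂ occ q t))
        (subst₂ _<_ (sym σfq≡u) (sym (trans (cong (lookup σ) ft≡s) σs≡s)) u<s)
      τq<|τ| : lookup τ q < length τ
      τq<|τ| = <-≤-trans τq<τt (≤-trans (τ-inversion t) (<⇒≤ (Fin.toℕ<n t)))
      k : Fin (length τ)
      k = fromℕ< τq<|τ|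
      fk<s : toℕ (f k) < toℕ s
      fk<s = subst (λ x → toℕ (f k) < toℕ x) ft≡s (proj₁ occ k t
        (subst (_< toℕ t) (sym (Fin.toℕ-fromℕ< τq<|τ|)) (<-≤-trans τq<τt (τ-inversion t))))
    ... | no u∉σf with valueElsewhere p u u<s (λ a → u∉σf ∘ (a ,_))
    ...   | r , r≢p , σr≡u = r , missing<s r r∉f , r≢p , byValue σr≡u r∉f
      where
      r∉f : ∀ a → f a ≢ r
      r∉f a fa≡r = u∉σf (a , trans (cong (lookup σ) fa≡r) σr≡u)

  occurrence-surjective : ∀ j → ∃[ a ] f a ≡ j
  occurrence-surjective p with Fin.any? (λ a → f a Fin.≟ p)
  ... | yes p∈f = p∈f
  ... | no  p∉imf = ⊥-elim (noInjection-avoiding F p (missing<s p p∉f) F<s F≢p F-injective)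
    where
    p∉f : ∀ a → f a ≢ p
    p∉f a = p∉imf ∘ (a ,_)
    encoded : (u : Fin (toℕ s)) →
              Σ[ r ∈ Fin (length σ) ] toℕ r < toℕ s × r ≢ p × Encodes (toℕ u) r
    encoded u = encode p p∉f (toℕ u) (Fin.toℕ<n u)
    F : Fin (toℕ s) → Fin (length σ)
    F u = proj₁ (encoded u)
    F<s : ∀ u → toℕ (F u) < toℕ s
    F<s u = proj₁ (proj₂ (encoded u))
    F≢p : ∀ u → F u ≢ p
    F≢p u = proj₁ (proj₂ (proj₂ (encoded u)))
    F-injective : Injective _≡_ _≡_ F
    F-injective {u} {v} Fu≡Fv = Fin.toℕ-injective (encodes-injective
      (proj₂ (proj₂ (proj₂ (encoded u))))
      (subst (Encodes (toℕ v)) (sym Fu≡Fv) (proj₂ (proj₂ (proj₂ (encoded v))))))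

DownClosed : ∀ {m} → (Fin m → ℕ) → Set
DownClosed x = ∀ i w → w < x i → ∃[ a ] x a ≡ w

downClosed-≤ : ∀ {m} (x y : Fin m → ℕ) → DownClosed x →
               (∀ a b → x a < x b → y a < y b) → ∀ i → x i ≤ y i
downClosed-≤ x y below mono i = go (x i) i refl
  where
  go : ∀ v i → x i ≡ v → v ≤ y i
  go zero    i _     = z≤n
  go (suc w) i xi≡1+w =
    let a , xa≡w = below i w (subst (w <_) (sym xi≡1+w) (n<1+n w))
    in ≤-<-trans (go w a xa≡w) (mono a i (subst₂ _<_ (sym xa≡w) (sym xi≡1+w) (n<1+n w)))

≡-viaStrictIncSurjection : ∀ (xs ys : List ℕ) (f : Fin (length xs) → Fin (length ys)) →
  StrictInc f → (∀ j → ∃[ a ] f a ≡ j) → (∀ a → lookup xs a ≡ lookup ys (f a)) → xs ≡ ys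
≡-viaStrictIncSurjection []       []       _ _   _    _  = refl
≡-viaStrictIncSurjection []       (_ ∷ _)  _ _   surj _  with surj zero
... | () , _
≡-viaStrictIncSurjection (_ ∷ _)  []       f _   _    _  with f zero
... | ()
≡-viaStrictIncSurjection (x ∷ xs) (y ∷ ys) f inc surj xs≡ys∘f =
  cong₂ _∷_ (trans (xs≡ys∘f zero) (cong (lookup (y ∷ ys)) f0≡0))
            (≡-viaStrictIncSurjection xs ys f′ inc′ surj′ λ a →
               trans (xs≡ys∘f (suc a)) (cong (lookup (y ∷ ys)) (sym (suc-f′ a))))
  where
  f0≡0 : f zero ≡ zero
  f0≡0 with surj zero
  ... | zero  , f0≡z = f0≡z
  ... | suc a , fa≡0 =
    ⊥-elim (n≮0 (subst (λ j → toℕ (f zero) < toℕ j) fa≡0 (inc zero (suc a) z<s)))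
  0≢f∘suc : ∀ a → zero ≢ f (suc a)
  0≢f∘suc a 0≡fa = Fin.0≢1+n (strictInc-injective inc (trans f0≡0 0≡fa))
  f′ : Fin (length xs) → Fin (length ys)
  f′ a = punchOut (0≢f∘suc a)
  suc-f′ : ∀ a → suc (f′ a) ≡ f (suc a)
  suc-f′ a = Fin.punchIn-punchOut (0≢f∘suc a)
  inc′ : StrictInc f′
  inc′ a b a<b = ℕ.s<s⁻¹ (subst₂ (λ u v → toℕ u < toℕ v) (sym (suc-f′ a)) (sym (suc-f′ b))
                                 (inc (suc a) (suc b) (s<s a<b)))
  surj′ : ∀ j → ∃[ a ] f′ a ≡ j
  surj′ j with surj (suc j)
  ... | zero  , f0≡1+j = ⊥-elim (Fin.0≢1+n (trans (sym f0≡0) f0≡1+j))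
  ... | suc a , fa≡1+j = a , Fin.suc-injective (trans (suc-f′ a) fa≡1+j)

surjectiveOccurrence⇒≡ : ∀ {τ σ f} → IsCayley τ → IsCayley σ → IsOccurrence τ σ f →
  (∀ j → ∃[ a ] f a ≡ j) → τ ≡ σ
surjectiveOccurrence⇒≡ {τ} {σ} {f} τ-cayley σ-cayley occ surj =
  ≡-viaStrictIncSurjection τ σ f (proj₁ occ) surj λ a → ≤-antisym
    (downClosed-≤ (lookup τ) (lookup σ ∘ f) τ-below (λ a b → to (proj₁ (proj₂ occ a b))) a)
    (downClosed-≤ (lookup σ ∘ f) (lookup τ) σf-below (λ a b → from (proj₁ (proj₂ occ a b))) a)
  where
  τ-below : DownClosed (lookup τ)
  τ-below i w w<τi = τ-cayley w (i , <⇒≤ w<τi)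
  σf-below : DownClosed (lookup σ ∘ f)
  σf-below i w w<σfi =
    let j , σj≡w = σ-cayley w (f i , <⇒≤ w<σfi)
        a , fa≡j = surj j
    in a , trans (cong (lookup σ) fa≡j) σj≡w

inversionSeq-fixedPoint : ∀ {σ} → IsInversionSeq σ → 1 ≤ length σ → ∃[ j ] lookup σ j ≡ toℕ j
inversionSeq-fixedPoint {x ∷ xs} inv _ = zero , n≤0⇒n≡0 (inv zero)

conditions⇒minimal : ∀ {ρ σ} → 1 ≤ length σ → IsInversionSeq σ → IsCayley σ → Contains ρ σ →
  (∀ e → IsOccurrence ρ σ e → Cond1 ρ σ e × Cond2 ρ σ e) → IsMinimal ρ σ
conditions⇒minimal {ρ} {σ} σ≢[] inv cay ρ⊆σ conds = (inv , cay , ρ⊆σ) , below⇒≡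
  where
  greatestFixed : ∃[ s ] lookup σ s ≡ toℕ s × (∀ j → lookup σ j ≡ toℕ j → toℕ j ≤ toℕ s)
  greatestFixed = greatest (λ j → lookup σ j ≟ toℕ j) (inversionSeq-fixedPoint {σ} inv σ≢[])

  s : Fin (length σ)
  s = proj₁ greatestFixed

  below⇒≡ : ∀ τ → InIP ρ τ → Contains τ σ → τ ≡ σ
  below⇒≡ τ (τ-inv , τ-cay , _ , g , ρ⊆τ) (_ , f , τ⊆σ) =
    surjectiveOccurrence⇒≡ {τ} {σ} τ-cay cay τ⊆σ
      (occurrence-surjective {σ} {τ} cay τ-inv τ⊆σ s (proj₁ (proj₂ greatestFixed)) covers repeats)
    where
    ρ⊆σ′ : IsOccurrence ρ σ (f ∘ g)
    ρ⊆σ′ = occurrence-∘ {ρ} {τ} {σ} ρ⊆τ τ⊆σ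

    cond1 : Cond1 ρ σ (f ∘ g)
    cond1 = proj₁ (conds (f ∘ g) ρ⊆σ′)

    cond2 : Cond2 ρ σ (f ∘ g)
    cond2 = proj₂ (conds (f ∘ g) ρ⊆σ′)

    covers : ∀ j → toℕ s ≤ toℕ j → ∃[ a ] f a ≡ j
    covers j s≤j =
      let a , fga≡j = cond1 j λ s′ sat →
            ≤-trans (proj₂ (proj₂ greatestFixed) s′ (to (inSat⇔fixed σ inv σ≢[] s′) sat)) s≤j
      in g a , fga≡j

    repeats : ∀ i → (∀ a → lookup σ (f a) ≢ lookup σ i) →
              ∃[ i′ ] i′ ≢ i × lookup σ i′ ≡ lookup σ i
    repeats i σi∉σf with cond2 i (σi∉σf ∘ g)
    ... | i₁ , i₂ , i₁≢i₂ , σi₁≡σi , σi₂≡σi with i₁ Fin.≟ i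
    ...   | yes refl = i₂ , i₁≢i₂ ∘ sym , σi₂≡σi
    ...   | no i₁≢i  = i₁ , i₁≢i , σi₁≡σi

proposition3p1 : (ρ σ : List ℕ) → 1 ≤ length σ → 1 ≤ length ρ →
    IsCayley ρ → IsInversionSeq σ → IsCayley σ → Contains ρ σ →
    (IsMinimal ρ σ ⇔ (∀ e → IsOccurrence ρ σ e → Cond1 ρ σ e × Cond2 ρ σ e))
proposition3p1 ρ σ σ≢[] _ _ inv cay ρ⊆σ =
  mk⇔ (minimal⇒conditions {ρ} σ≢[] inv cay) (conditions⇒minimal {ρ} σ≢[] inv cay ρ⊆σ)
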